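{- Let $c$ be a positive integer and let $(L,Q_1,\ldots,Q_n,R)$ be a $(4,c)$-flexipath in a matroid $M$. Then for all $i\in[n]$, $$\sqcap(L,Q_i)+\sqcap^*(L,Q_i)=c=\sqcap(R,Q_i)+\sqcap^*(R,Q_i).$$
   Context: Let $M$ be a matroid on ground set $E$ with rank function $r$. $\lambda(A)=r(A)+r(E-A)-r(M)$; for disjoint $X,Y$, $\sqcap(X,Y)=r(X)+r(Y)-r(X\cup Y)$ and $\sqcap^*(X,Y)$ is the same quantity in $M^*$; $\kappa(X,Y)=\min\{\lambda(Z):X\subseteq Z\subseteq E-Y\}$. A path of $4$-separations is an ordered partition $(L,P_1,\ldots,P_n,R)$ of $E$ with $\kappa(L,R)=3$ and $\lambda(L\cup P_1\cup\cdots\cup P_i)=3$ for all $i\in\{0,\ldots,n\}$; a $4$-flexipath if this holds for every reordering of $P_1,\ldots,P_n$ (with $L,R$ fixed); a $(4,c)$-flexipath if moreover $\lambda(P_i)=c$ for all $i$ and $\lambda(P_i\cup P_j)>c$ for all distinct $i,j$. -}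

module Defs where

open import Data.Nat using (ℕ; _+_; _∸_; _≤_; _<_)
open import Data.Fin using (Fin)
open import Data.Fin.Subset using (Subset; _∪_; _∩_; ∁; ⊥; ⊤; ∣_∣; _⊆_; ⋃)
open import Data.Fin.Permutation using (Permutation′; _⟨$⟩ʳ_)
open import Data.List using (List; map; take; allFin)
open import Data.Product using (Σ; _×_)
open import Relation.Binary.PropositionalEquality using (_≡_; _≢_)

record Matroid (m : ℕ) : Set where
  field
    r           : Subset m → ℕ
    r-bounded   : ∀ X → r X ≤ ∣ X ∣
    r-monotone  : ∀ X Y → X ⊆ Y → r X ≤ r Y
    r-submod    : ∀ X Y → r (X ∪ Y) + r (X ∩ Y) ≤ r X + r Y

module _ {m : ℕ} (M : Matroid m) where
  open Matroid M

  rM : ℕ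
  rM = r ⊤

  -- connectivity function λ(A) = r(A) + r(E - A) - r(M)  (always ≥ 0)
  conn : Subset m → ℕ
  conn A = (r A + r (∁ A)) ∸ rM

  -- dual rank r*(X) = |X| + r(E - X) - r(M)  (always ≥ 0)
  rank* : Subset m → ℕ
  rank* X = (∣ X ∣ + r (∁ X)) ∸ rM

  -- local connectivity ⊓(X,Y) = r(X) + r(Y) - r(X ∪ Y)  (always ≥ 0)
  sqcap : Subset m → Subset m → ℕ
  sqcap X Y = (r X + r Y) ∸ r (X ∪ Y)

  sqcap* : Subset m → Subset m → ℕ
  sqcap* X Y = (rank* X + rank* Y) ∸ rank* (X ∪ Y)

  -- κ(X,Y) = k, i.e. min{ λ(Z) : X ⊆ Z ⊆ E - Y } = k
  κ≡ : Subset m → Subset m → ℕ → Set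
  κ≡ X Y k =
    Σ (Subset m) (λ Z → X ⊆ Z × Z ⊆ ∁ Y × conn Z ≡ k)
    × (∀ Z → X ⊆ Z → Z ⊆ ∁ Y → k ≤ conn Z)

  IsOrderedPartition : {n : ℕ} → Subset m → (Fin n → Subset m) → Subset m → Set
  IsOrderedPartition {n} L Q R =
    (L ∩ R ≡ ⊥)
    × (∀ i → L ∩ Q i ≡ ⊥)
    × (∀ i → R ∩ Q i ≡ ⊥)
    × (∀ i j → i ≢ j → Q i ∩ Q j ≡ ⊥)
    × (L ∪ (⋃ (map Q (allFin n)) ∪ R) ≡ ⊤)

  prefixUnion : {n : ℕ} → Subset m → (Fin n → Subset m) → Permutation′ n → ℕ → Subset m
  prefixUnion {n} L Q σ k = L ∪ ⋃ (take k (map (λ j → Q (σ ⟨$⟩ʳ j)) (allFin n)))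

  IsPath4 : {n : ℕ} → Subset m → (Fin n → Subset m) → Subset m → Set
  IsPath4 {n} L Q R =
    IsOrderedPartition L Q R
    × κ≡ L R 3
    × (∀ k → k ≤ n → conn (L ∪ ⋃ (take k (map Q (allFin n)))) ≡ 3)

  IsFlexipath4 : {n : ℕ} → Subset m → (Fin n → Subset m) → Subset m → Set
  IsFlexipath4 {n} L Q R =
    IsOrderedPartition L Q R
    × κ≡ L R 3
    × (∀ (σ : Permutation′ n) → ∀ k → k ≤ n → conn (prefixUnion L Q σ k) ≡ 3)

  IsFlexipath4c : ℕ → {n : ℕ} → Subset m → (Fin n → Subset m) → Subset m → Set
  IsFlexipath4c c {n} L Q R =
    IsFlexipath4 L Q R
    × (∀ i → conn (Q i) ≡ c)
    × (∀ i j → i ≢ j → c < conn (Q i ∪ Q j))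

module Submission where

-- For disjoint X and Y, submodularity of r on X, Y and on E − X, E − Y (whose union is E)
-- makes every truncated subtraction in the definitions exact, and one obtains
--   ⊓(X,Y) + ⊓*(X,Y) + λ(X ∪ Y) = λ(X) + λ(Y).
-- Moving Q_i to the front of the flexipath gives λ(L ∪ Q_i) = 3 = λ(L); moving it to the back
-- gives λ(E − (R ∪ Q_i)) = 3 = λ(E − R), and λ is invariant under complementation. So for
-- X ∈ {L, R} we have λ(X ∪ Q_i) = λ(X), and the identity leaves ⊓ + ⊓* = λ(Q_i) = c.

open import Defs
open import Algebra.Lattice.Properties.BooleanAlgebra as BooleanAlgebraProperties using ()
open import Data.Empty using (⊥-elim)
open import Data.Fin using (Fin; toℕ; fromℕ; zero; suc)
open import Data.Fin.Permutation using (Permutation′; _⟨$⟩ʳ_; _⟨$⟩ˡ_; id; transpose; inverseˡ; inverseʳ)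
open import Data.Fin.Properties using (toℕ-injective; toℕ<n; toℕ≤pred[n]; toℕ-fromℕ; _≟_)
open import Data.Fin.Subset using (Subset; inside; outside; _∈_; _∉_; _∪_; _∩_; ∁; ⊥; ⊤; ∣_∣; _⊆_; ⋃)
open import Data.Fin.Subset.Properties
  using (∪-∩-booleanAlgebra; p∪∁p≡⊤; ∪-identityʳ; ∩-zeroʳ; ⊆-antisym; ∈⊤; ∉⊥;
         x∈p∪q⁺; x∈p∪q⁻; x∈p∩q⁺; x∈∁p⇒x∉p; x∉p⇒x∈∁p)
open import Data.List using (map; take; tabulate; allFin)
open import Data.List.Properties using (map-tabulate)
open import Data.Nat using (ℕ; suc; _+_; _∸_; _≤_; _<_; z≤n; s≤s)
open import Data.Nat.Properties
  using (≤-trans; ≤-antisym; ≤-refl; m≤m+n; n≤1+n; +-monoˡ-≤; +-comm; +-assoc; +-suc; +-commutativeSemigroup; +-cancelʳ-≡;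
         m∸n+n≡m; [m+n]∸[m+o]≡n∸o; <⇒≱; ≮⇒≥; <-irrefl; _<?_; module ≤-Reasoning)
open import Data.Nat.Tactic.RingSolver using (solve-∀)
open import Algebra.Properties.CommutativeSemigroup +-commutativeSemigroup using (interchange)
open import Data.Product using (_×_; _,_; ∃-syntax)
open import Data.Sum using (_⊎_; inj₁; inj₂)
open import Data.Vec using (_∷_; [])
open import Data.Vec.Properties using (∷-injectiveʳ)
open import Relation.Nullary using (yes; no)
open import Relation.Binary.PropositionalEquality
  using (_≡_; _≢_; refl; sym; trans; cong; cong₂; subst; module ≡-Reasoning)

∣p∪q∣≡∣p∣+∣q∣ : ∀ {m} (p q : Subset m) → p ∩ q ≡ ⊥ → ∣ p ∪ q ∣ ≡ ∣ p ∣ + ∣ q ∣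
∣p∪q∣≡∣p∣+∣q∣ [] [] _ = refl
∣p∪q∣≡∣p∣+∣q∣ (inside ∷ p) (inside ∷ q) ()
∣p∪q∣≡∣p∣+∣q∣ (inside ∷ p) (outside ∷ q) e = cong suc (∣p∪q∣≡∣p∣+∣q∣ p q (∷-injectiveʳ e))
∣p∪q∣≡∣p∣+∣q∣ (outside ∷ p) (inside ∷ q) e =
  trans (cong suc (∣p∪q∣≡∣p∣+∣q∣ p q (∷-injectiveʳ e))) (sym (+-suc ∣ p ∣ ∣ q ∣))
∣p∪q∣≡∣p∣+∣q∣ (outside ∷ p) (outside ∷ q) e = ∣p∪q∣≡∣p∣+∣q∣ p q (∷-injectiveʳ e)

module _ {m : ℕ} where
  open BooleanAlgebraProperties (∪-∩-booleanAlgebra m) using (deMorgan₁; ¬⊥≈⊤)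

  ∁p∪∁q≡⊤ : ∀ {p q : Subset m} → p ∩ q ≡ ⊥ → ∁ p ∪ ∁ q ≡ ⊤
  ∁p∪∁q≡⊤ {p} {q} p∩q≡⊥ = trans (sym (deMorgan₁ p q)) (trans (cong ∁ p∩q≡⊥) ¬⊥≈⊤)

module _ {m : ℕ} (M : Matroid m) where
  open Matroid M
  open BooleanAlgebraProperties (∪-∩-booleanAlgebra m) using (¬-involutive; deMorgan₂)

  rM≤r+r∁ : ∀ A → rM M ≤ r A + r (∁ A)
  rM≤r+r∁ A = begin
    r ⊤                       ≡⟨ cong r (p∪∁p≡⊤ A) ⟨
    r (A ∪ ∁ A)               ≤⟨ m≤m+n _ _ ⟩
    r (A ∪ ∁ A) + r (A ∩ ∁ A) ≤⟨ r-submod A (∁ A) ⟩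
    r A + r (∁ A)             ∎
    where open ≤-Reasoning

  conn+rM≡rA+r∁A : ∀ A → conn M A + rM M ≡ r A + r (∁ A)
  conn+rM≡rA+r∁A A = m∸n+n≡m (rM≤r+r∁ A)

  rank*+rM≡∣A∣+r∁A : ∀ A → rank* M A + rM M ≡ ∣ A ∣ + r (∁ A)
  rank*+rM≡∣A∣+r∁A A = m∸n+n≡m (≤-trans (rM≤r+r∁ A) (+-monoˡ-≤ _ (r-bounded A)))

  sqcap+r[X∪Y]≡rX+rY : ∀ X Y → sqcap M X Y + r (X ∪ Y) ≡ r X + r Y
  sqcap+r[X∪Y]≡rX+rY X Y = m∸n+n≡m (≤-trans (m≤m+n (r (X ∪ Y)) (r (X ∩ Y))) (r-submod X Y))

  conn-∁ : ∀ A → conn M (∁ A) ≡ conn M A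
  conn-∁ A = cong (_∸ rM M) (begin
    r (∁ A) + r (∁ (∁ A)) ≡⟨ cong (λ B → r (∁ A) + r B) (¬-involutive A) ⟩
    r (∁ A) + r A         ≡⟨ +-comm (r (∁ A)) (r A) ⟩
    r A + r (∁ A)         ∎)
    where open ≡-Reasoning

  module _ {X Y : Subset m} (X∩Y≡⊥ : X ∩ Y ≡ ⊥) where

    sqcap*≡[r∁X+r∁Y]∸[r∁[X∪Y]+rM] : sqcap* M X Y ≡ (r (∁ X) + r (∁ Y)) ∸ (r (∁ (X ∪ Y)) + rM M)
    sqcap*≡[r∁X+r∁Y]∸[r∁[X∪Y]+rM] = begin
      (rX* + rY*) ∸ rXY*
        ≡⟨ [m+n]∸[m+o]≡n∸o (t + t) (rX* + rY*) rXY* ⟨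
      ((t + t) + (rX* + rY*)) ∸ ((t + t) + rXY*)
        ≡⟨ cong₂ _∸_ (trans (+-comm (t + t) _) (interchange rX* rY* t t))
                     (trans (+-comm (t + t) rXY*) (sym (+-assoc rXY* t t))) ⟩
      ((rX* + t) + (rY* + t)) ∸ ((rXY* + t) + t)
        ≡⟨ cong₂ _∸_ (cong₂ _+_ (rank*+rM≡∣A∣+r∁A X) (rank*+rM≡∣A∣+r∁A Y)) (cong (_+ t) (rank*+rM≡∣A∣+r∁A (X ∪ Y))) ⟩
      ((∣ X ∣ + x) + (∣ Y ∣ + y)) ∸ ((∣ X ∪ Y ∣ + w) + t)
        ≡⟨ cong (λ s → ((∣ X ∣ + x) + (∣ Y ∣ + y)) ∸ ((s + w) + t)) (∣p∪q∣≡∣p∣+∣q∣ X Y X∩Y≡⊥) ⟩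
      ((∣ X ∣ + x) + (∣ Y ∣ + y)) ∸ (((∣ X ∣ + ∣ Y ∣) + w) + t)
        ≡⟨ cong₂ _∸_ (interchange (∣ X ∣) x (∣ Y ∣) y) (+-assoc (∣ X ∣ + ∣ Y ∣) w t) ⟩
      ((∣ X ∣ + ∣ Y ∣) + (x + y)) ∸ ((∣ X ∣ + ∣ Y ∣) + (w + t))
        ≡⟨ [m+n]∸[m+o]≡n∸o (∣ X ∣ + ∣ Y ∣) (x + y) (w + t) ⟩
      (x + y) ∸ (w + t) ∎
      where
      open ≡-Reasoning
      rX* rY* rXY* x y w t : ℕ
      rX* = rank* M X
      rY* = rank* M Y
      rXY* = rank* M (X ∪ Y)
      x = r (∁ X)
      y = r (∁ Y)
      w = r (∁ (X ∪ Y))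
      t = rM M

    r∁[X∪Y]+rM≤r∁X+r∁Y : r (∁ (X ∪ Y)) + rM M ≤ r (∁ X) + r (∁ Y)
    r∁[X∪Y]+rM≤r∁X+r∁Y = begin
      r (∁ (X ∪ Y)) + r ⊤             ≡⟨ cong₂ (λ A B → r A + r B) (deMorgan₂ X Y) (sym (∁p∪∁q≡⊤ X∩Y≡⊥)) ⟩
      r (∁ X ∩ ∁ Y) + r (∁ X ∪ ∁ Y)   ≡⟨ +-comm (r (∁ X ∩ ∁ Y)) (r (∁ X ∪ ∁ Y)) ⟩
      r (∁ X ∪ ∁ Y) + r (∁ X ∩ ∁ Y)   ≤⟨ r-submod (∁ X) (∁ Y) ⟩
      r (∁ X) + r (∁ Y)               ∎
      where open ≤-Reasoning

    sqcap*+r∁[X∪Y]+rM≡r∁X+r∁Y : sqcap* M X Y + (r (∁ (X ∪ Y)) + rM M) ≡ r (∁ X) + r (∁ Y)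
    sqcap*+r∁[X∪Y]+rM≡r∁X+r∁Y =
      trans (cong (_+ (r (∁ (X ∪ Y)) + rM M)) sqcap*≡[r∁X+r∁Y]∸[r∁[X∪Y]+rM]) (m∸n+n≡m r∁[X∪Y]+rM≤r∁X+r∁Y)

    sqcap+sqcap*+conn[X∪Y]≡connX+connY : sqcap M X Y + sqcap* M X Y + conn M (X ∪ Y) ≡ conn M X + conn M Y
    sqcap+sqcap*+conn[X∪Y]≡connX+connY = +-cancelʳ-≡ ((u + w) + (t + t)) _ _ (begin
      (⊓ + ⊓* + λ∪) + ((u + w) + (t + t))  ≡⟨ regroupˡ ⊓ ⊓* λ∪ u w t ⟩
      (⊓ + u) + (⊓* + (w + t)) + (λ∪ + t)  ≡⟨ cong₂ (λ A B → A + B + (λ∪ + t)) (sqcap+r[X∪Y]≡rX+rY X Y) sqcap*+r∁[X∪Y]+rM≡r∁X+r∁Y ⟩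
      (a + b) + (x + y) + (λ∪ + t)         ≡⟨ cong₂ _+_ (interchange a b x y) (conn+rM≡rA+r∁A (X ∪ Y)) ⟩
      (a + x) + (b + y) + (u + w)          ≡⟨ cong₂ (λ A B → A + B + (u + w)) (conn+rM≡rA+r∁A X) (conn+rM≡rA+r∁A Y) ⟨
      (λX + t) + (λY + t) + (u + w)        ≡⟨ regroupʳ λX λY u w t ⟩
      (λX + λY) + ((u + w) + (t + t))      ∎)
      where
      open ≡-Reasoning
      a b u x y w t ⊓ ⊓* λ∪ λX λY : ℕ
      a = r X
      b = r Y
      u = r (X ∪ Y)
      x = r (∁ X)
      y = r (∁ Y)
      w = r (∁ (X ∪ Y))
      t = rM M
      ⊓ = sqcap M X Y
      ⊓* = sqcap* M X Y
      λ∪ = conn M (X ∪ Y)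
      λX = conn M X
      λY = conn M Y
      regroupˡ : ∀ p q l u w t → (p + q + l) + ((u + w) + (t + t)) ≡ (p + u) + (q + (w + t)) + (l + t)
      regroupˡ = solve-∀
      regroupʳ : ∀ p q u w t → (p + t) + (q + t) + (u + w) ≡ (p + q) + ((u + w) + (t + t))
      regroupʳ = solve-∀

    sqcap+sqcap*≡connY : conn M (X ∪ Y) ≡ conn M X → sqcap M X Y + sqcap* M X Y ≡ conn M Y
    sqcap+sqcap*≡connY conn∪≡connX = +-cancelʳ-≡ (conn M X) _ _ (begin
      sqcap M X Y + sqcap* M X Y + conn M X       ≡⟨ cong (sqcap M X Y + sqcap* M X Y +_) conn∪≡connX ⟨
      sqcap M X Y + sqcap* M X Y + conn M (X ∪ Y) ≡⟨ sqcap+sqcap*+conn[X∪Y]≡connX+connY ⟩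
      conn M X + conn M Y                         ≡⟨ +-comm (conn M X) (conn M Y) ⟩
      conn M Y + conn M X                         ∎)
      where open ≡-Reasoning

x∈⋃tabulate⁻ : ∀ {m n} (f : Fin n → Subset m) {x} → x ∈ ⋃ (tabulate f) → ∃[ j ] x ∈ f j
x∈⋃tabulate⁻ {n = 0} f x∈⋃ = ⊥-elim (∉⊥ x∈⋃)
x∈⋃tabulate⁻ {n = suc n} f x∈⋃ with x∈p∪q⁻ (f zero) _ x∈⋃
... | inj₁ x∈f0 = zero , x∈f0
... | inj₂ x∈⋃′ with x∈⋃tabulate⁻ (λ j → f (suc j)) x∈⋃′
...   | j , x∈fj = suc j , x∈fj

x∈⋃take⁻ : ∀ {m n} k (f : Fin n → Subset m) {x} → x ∈ ⋃ (take k (tabulate f)) → ∃[ j ] toℕ j < k × x ∈ f j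
x∈⋃take⁻             0       f x∈⋃ = ⊥-elim (∉⊥ x∈⋃)
x∈⋃take⁻ {n = 0}     (suc k) f x∈⋃ = ⊥-elim (∉⊥ x∈⋃)
x∈⋃take⁻ {n = suc n} (suc k) f x∈⋃ with x∈p∪q⁻ (f zero) _ x∈⋃
... | inj₁ x∈f0 = zero , s≤s z≤n , x∈f0
... | inj₂ x∈⋃′ with x∈⋃take⁻ k (λ j → f (suc j)) x∈⋃′
...   | j , j<k , x∈fj = suc j , s≤s j<k , x∈fj

x∈⋃take⁺ : ∀ {m n} k (f : Fin n → Subset m) {x} j → toℕ j < k → x ∈ f j → x ∈ ⋃ (take k (tabulate f))
x∈⋃take⁺ (suc k) f zero    _         x∈fj = x∈p∪q⁺ (inj₁ x∈fj)
x∈⋃take⁺ (suc k) f (suc j) (s≤s j<k) x∈fj = x∈p∪q⁺ (inj₂ (x∈⋃take⁺ k (λ j → f (suc j)) j j<k x∈fj))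

∩≡⊥⇒∉ : ∀ {m} {p q : Subset m} {x} → p ∩ q ≡ ⊥ → x ∈ p → x ∉ q
∩≡⊥⇒∉ p∩q≡⊥ x∈p x∈q = ∉⊥ (subst (_ ∈_) p∩q≡⊥ (x∈p∩q⁺ (x∈p , x∈q)))

transpose-i↦j : ∀ {n} (i j : Fin n) → transpose i j ⟨$⟩ʳ i ≡ j
transpose-i↦j i j with i ≟ i
... | yes _   = refl
... | no  i≢i = ⊥-elim (i≢i refl)

n≤toℕ⇒≡fromℕ : ∀ {n} (j : Fin (suc n)) → n ≤ toℕ j → j ≡ fromℕ n
n≤toℕ⇒≡fromℕ {n} j n≤j = toℕ-injective (trans (≤-antisym (toℕ≤pred[n] j) n≤j) (sym (toℕ-fromℕ n)))

module _ {m n : ℕ} (M : Matroid m) {L R : Subset m} {Q : Fin n → Subset m} where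

  x∈prefixUnion⁻ : ∀ σ k {x} → x ∈ prefixUnion M L Q σ k → x ∈ L ⊎ ∃[ j ] toℕ j < k × x ∈ Q (σ ⟨$⟩ʳ j)
  x∈prefixUnion⁻ σ k {x} x∈P with x∈p∪q⁻ L _ x∈P
  ... | inj₁ x∈L = inj₁ x∈L
  ... | inj₂ x∈⋃ = inj₂ (x∈⋃take⁻ k (λ j → Q (σ ⟨$⟩ʳ j))
                           (subst (λ A → x ∈ ⋃ (take k A)) (map-tabulate (λ j → j) _) x∈⋃))

  x∈prefixUnion⁺ : ∀ σ k {x} j → toℕ j < k → x ∈ Q (σ ⟨$⟩ʳ j) → x ∈ prefixUnion M L Q σ k
  x∈prefixUnion⁺ σ k {x} j j<k x∈Qσj =
    x∈p∪q⁺ (inj₂ (subst (λ A → x ∈ ⋃ (take k A)) (sym (map-tabulate (λ j → j) _))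
                    (x∈⋃take⁺ k (λ j → Q (σ ⟨$⟩ʳ j)) j j<k x∈Qσj)))

  x∈L⊎Q⊎R : IsOrderedPartition M L Q R → ∀ x → x ∈ L ⊎ (∃[ j ] x ∈ Q j) ⊎ x ∈ R
  x∈L⊎Q⊎R (_ , _ , _ , _ , cover) x with x∈p∪q⁻ L _ (subst (x ∈_) (sym cover) ∈⊤)
  ... | inj₁ x∈L = inj₁ x∈L
  ... | inj₂ x∈Q∪R with x∈p∪q⁻ (⋃ (map Q (allFin n))) R x∈Q∪R
  ...   | inj₁ x∈⋃Q = inj₂ (inj₁ (x∈⋃tabulate⁻ Q (subst (λ A → x ∈ ⋃ A) (map-tabulate (λ j → j) Q) x∈⋃Q)))
  ...   | inj₂ x∈R  = inj₂ (inj₂ x∈R)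

  ∁[R∪S]≡prefixUnion : IsOrderedPartition M L Q R → ∀ σ k (S : Subset m)
    → L ∩ S ≡ ⊥
    → (∀ j → toℕ j < k → Q (σ ⟨$⟩ʳ j) ∩ S ≡ ⊥)
    → (∀ j → k ≤ toℕ j → Q (σ ⟨$⟩ʳ j) ⊆ S)
    → ∁ (R ∪ S) ≡ prefixUnion M L Q σ k
  ∁[R∪S]≡prefixUnion part@(L∩R≡⊥ , _ , R∩Q≡⊥ , _ , _) σ k S L∩S≡⊥ early∩S≡⊥ late⊆S =
    ⊆-antisym (λ x∈∁ → outside⇒prefix (x∈∁p⇒x∉p x∈∁)) (λ x∈P → x∉p⇒x∈∁p (prefix⇒outside x∈P))
    where
    outside⇒Qσ-prefix : ∀ {x} j → x ∈ Q (σ ⟨$⟩ʳ j) → x ∉ R ∪ S → x ∈ prefixUnion M L Q σ k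
    outside⇒Qσ-prefix j x∈Qσj x∉R∪S with toℕ j <? k
    ... | yes j<k = x∈prefixUnion⁺ σ k j j<k x∈Qσj
    ... | no  j≮k = ⊥-elim (x∉R∪S (x∈p∪q⁺ (inj₂ (late⊆S j (≮⇒≥ j≮k) x∈Qσj))))

    outside⇒prefix : ∀ {x} → x ∉ R ∪ S → x ∈ prefixUnion M L Q σ k
    outside⇒prefix {x} x∉R∪S with x∈L⊎Q⊎R part x
    ... | inj₁ x∈L               = x∈p∪q⁺ (inj₁ x∈L)
    ... | inj₂ (inj₁ (j , x∈Qj)) =
      outside⇒Qσ-prefix (σ ⟨$⟩ˡ j) (subst (λ l → x ∈ Q l) (sym (inverseʳ σ)) x∈Qj) x∉R∪S
    ... | inj₂ (inj₂ x∈R)        = ⊥-elim (x∉R∪S (x∈p∪q⁺ (inj₁ x∈R)))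

    prefix⇒outside : ∀ {x} → x ∈ prefixUnion M L Q σ k → x ∉ R ∪ S
    prefix⇒outside x∈P x∈R∪S with x∈prefixUnion⁻ σ k x∈P | x∈p∪q⁻ R S x∈R∪S
    ... | inj₁ x∈L               | inj₁ x∈R = ∩≡⊥⇒∉ L∩R≡⊥ x∈L x∈R
    ... | inj₁ x∈L               | inj₂ x∈S = ∩≡⊥⇒∉ L∩S≡⊥ x∈L x∈S
    ... | inj₂ (j , _ , x∈Qσj)   | inj₁ x∈R = ∩≡⊥⇒∉ (R∩Q≡⊥ (σ ⟨$⟩ʳ j)) x∈R x∈Qσj
    ... | inj₂ (j , j<k , x∈Qσj) | inj₂ x∈S = ∩≡⊥⇒∉ (early∩S≡⊥ j j<k) x∈Qσj x∈S

  ∁R≡prefixUnion-all : IsOrderedPartition M L Q R → ∁ R ≡ prefixUnion M L Q id n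
  ∁R≡prefixUnion-all part =
    trans (cong ∁ (sym (∪-identityʳ R)))
          (∁[R∪S]≡prefixUnion part id n ⊥ (∩-zeroʳ L) (λ j _ → ∩-zeroʳ (Q j))
                                (λ j n≤j → ⊥-elim (<⇒≱ (toℕ<n j) n≤j)))

module _ {m n : ℕ} (M : Matroid m) {L R : Subset m} {Q : Fin (suc n) → Subset m} where

  ∁[R∪Qᵢ]≡prefixUnion-Qᵢ-last : IsOrderedPartition M L Q R → ∀ i
    → ∁ (R ∪ Q i) ≡ prefixUnion M L Q (transpose (fromℕ n) i) n
  ∁[R∪Qᵢ]≡prefixUnion-Qᵢ-last part@(_ , L∩Q≡⊥ , _ , Q∩Q≡⊥ , _) i =
    ∁[R∪S]≡prefixUnion M part τ n (Q i) (L∩Q≡⊥ i) early∩Qᵢ≡⊥ late⊆Qᵢ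
    where
    τ : Permutation′ (suc n)
    τ = transpose (fromℕ n) i

    early∩Qᵢ≡⊥ : ∀ j → toℕ j < n → Q (τ ⟨$⟩ʳ j) ∩ Q i ≡ ⊥
    early∩Qᵢ≡⊥ j j<n = Q∩Q≡⊥ (τ ⟨$⟩ʳ j) i τj≢i
      where
      τj≢i : τ ⟨$⟩ʳ j ≢ i
      τj≢i τj≡i = <-irrefl (trans (cong toℕ j≡last) (toℕ-fromℕ n)) j<n
        where
        j≡last : j ≡ fromℕ n
        j≡last = trans (sym (inverseˡ τ)) (trans (cong (τ ⟨$⟩ˡ_) τj≡i) (transpose-i↦j i (fromℕ n)))

    late⊆Qᵢ : ∀ j → n ≤ toℕ j → Q (τ ⟨$⟩ʳ j) ⊆ Q i
    late⊆Qᵢ j n≤j {x} = subst (λ l → x ∈ Q l) τj≡i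
      where
      τj≡i : τ ⟨$⟩ʳ j ≡ i
      τj≡i = trans (cong (τ ⟨$⟩ʳ_) (n≤toℕ⇒≡fromℕ j n≤j)) (transpose-i↦j (fromℕ n) i)

  conn[L∪Qᵢ]≡connL : IsFlexipath4 M L Q R → ∀ i → conn M (L ∪ Q i) ≡ conn M L
  conn[L∪Qᵢ]≡connL (_ , _ , conn-prefix≡3) i = begin
    conn M (L ∪ Q i)                                   ≡⟨ cong (λ A → conn M (L ∪ A)) (∪-identityʳ (Q i)) ⟨
    conn M (L ∪ (Q i ∪ ⊥))                             ≡⟨ cong (λ j → conn M (L ∪ (Q j ∪ ⊥))) (transpose-i↦j zero i) ⟨
    conn M (prefixUnion M L Q (transpose zero i) 1)    ≡⟨ conn-prefix≡3 (transpose zero i) 1 (s≤s z≤n) ⟩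
    3                                                  ≡⟨ conn-prefix≡3 id 0 z≤n ⟨
    conn M (L ∪ ⊥)                                     ≡⟨ cong (conn M) (∪-identityʳ L) ⟩
    conn M L                                           ∎
    where open ≡-Reasoning

  conn[R∪Qᵢ]≡connR : IsFlexipath4 M L Q R → ∀ i → conn M (R ∪ Q i) ≡ conn M R
  conn[R∪Qᵢ]≡connR (part , _ , conn-prefix≡3) i = begin
    conn M (R ∪ Q i)                                   ≡⟨ conn-∁ M (R ∪ Q i) ⟨
    conn M (∁ (R ∪ Q i))                               ≡⟨ cong (conn M) (∁[R∪Qᵢ]≡prefixUnion-Qᵢ-last part i) ⟩
    conn M (prefixUnion M L Q (transpose (fromℕ n) i) n) ≡⟨ conn-prefix≡3 (transpose (fromℕ n) i) n (n≤1+n n) ⟩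
    3                                                  ≡⟨ conn-prefix≡3 id (suc n) ≤-refl ⟨
    conn M (prefixUnion M L Q id (suc n))              ≡⟨ cong (conn M) (∁R≡prefixUnion-all M part) ⟨
    conn M (∁ R)                                       ≡⟨ conn-∁ M R ⟩
    conn M R                                           ∎
    where open ≡-Reasoning

lemma4p1 : (c : ℕ) → 0 < c → {m : ℕ} → (M : Matroid m) → {n : ℕ}
    → (L : Subset m) → (Q : Fin n → Subset m) → (R : Subset m)
    → IsFlexipath4c M c L Q R
    → ∀ (i : Fin n)
    → (sqcap M L (Q i) + sqcap* M L (Q i) ≡ c)
    × (sqcap M R (Q i) + sqcap* M R (Q i) ≡ c)
lemma4p1 c _ M {0} L Q R _ ()
lemma4p1 c _ M {suc n} L Q R (flexi@((_ , L∩Q≡⊥ , R∩Q≡⊥ , _) , _) , conn-Q≡c , _) i =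
  sqcap+sqcap*≡c L (L∩Q≡⊥ i) (conn[L∪Qᵢ]≡connL M flexi i) ,
  sqcap+sqcap*≡c R (R∩Q≡⊥ i) (conn[R∪Qᵢ]≡connR M flexi i)
  where
  sqcap+sqcap*≡c : ∀ X → X ∩ Q i ≡ ⊥ → conn M (X ∪ Q i) ≡ conn M X → sqcap M X (Q i) + sqcap* M X (Q i) ≡ c
  sqcap+sqcap*≡c X X∩Qᵢ≡⊥ conn-unchanged = trans (sqcap+sqcap*≡connY M X∩Qᵢ≡⊥ conn-unchanged) (conn-Q≡c i)
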